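{- Let $G$ be a connected simple graph with vertices $v_1,\dots,v_n$, $\mathbb{K}$ a field, and $A=(a_{ij})$ an $n\times n$ matrix over $\mathbb{K}$ with $a_{ij}=0$ whenever $i\neq j$ and $v_i,v_j$ are not adjacent. Let $\omega=w_1w_2\cdots w_m$ be a word over $\{v_1,\dots,v_n\}$ in which each $v_i$ occurs $m_i\ge 1$ times, and let $s=(m_1,\dots,m_n)$ (so $m=\sum_i m_i$). Let $B={}^e(A-I,s)$, an $m\times m$ matrix whose rows and columns are indexed by $u_1u_2\cdots u_m$, and let $\bar\omega=\bar w_1\cdots\bar w_m$ be the sequence obtained from $\omega$ by replacing the $k$-th occurrence of $v_i$ by $u_{\sum_{j=1}^{i-1}m_j+k}$. Then $$(G,A,\omega)=I+{}^c\big((I-B_{\bar\omega})^{ -1},s\big)(A-I).$$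
   Context: Linear SDS over a word: the local function of $v_i$ is $x_i\mapsto a_{i1}x_1+\cdots+a_{in}x_n$, inducing the $n\times n$ matrix $F_{v_i}$ equal to the identity except that its $i$-th row is $(a_{i1},\dots,a_{in})$; for the word $\omega=w_1\cdots w_m$ the system map is $(G,A,\omega)=F_{w_m}F_{w_{m-1}}\cdots F_{w_1}$. Block-expansion: for an $n\times n$ matrix $T=(t_{ij})$ and $s=(m_1,\dots,m_n)$ with $m_k\ge1$, ${}^e(T,s)$ is the $m\times m$ matrix obtained by replacing each entry $t_{ij}$ by an $m_i\times m_j$ block all of whose entries equal $t_{ij}$. Block-compression: for an $m\times m$ matrix $T$ and such $s$, ${}^c(T,s)$ is the $n\times n$ matrix whose $(r,l)$ entry is the sum of all entries of $T$ in rows $\sum_{k<r}m_k+1,\dots,\sum_{k\le r}m_k$ and columns $\sum_{k<l}m_k+1,\dots,\sum_{k\le l}m_k$. For a square matrix $T$ with rows and columns indexed by elements $u_1,\dots,u_m$ and a linear arrangement $\sigma$ of these elements, $T_\sigma$ is the matrix with $[T_\sigma]_{pq}=[T]_{pq}$ if $u_p$ appears after $u_q$ in $\sigma$ and $0$ otherwise. $I$ denotes the identity matrix of the appropriate size. -}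

module Defs where

open import Level using (Level; _⊔_; suc)
open import Algebra.Bundles using (CommutativeRing)
open import Data.Nat as ℕ using (ℕ; zero; _≤_)
open import Data.Fin as Fin using (Fin; toℕ)
open import Data.Product using (Σ; _×_; _,_; proj₁; proj₂)
open import Data.List using (List; []; _∷_; length; filter; map)
open import Data.Bool using (Bool; true; false; if_then_else_; _∧_)
open import Relation.Nullary using (¬_; Dec; yes; no; does)
open import Relation.Binary.PropositionalEquality using (_≡_)
import Data.Fin.Properties as FinP
import Data.Nat.Properties as ℕP

record Field (c ℓ : Level) : Set (Level.suc (c ⊔ ℓ)) where
  field
    commutativeRing : CommutativeRing c ℓ
  open CommutativeRing commutativeRing public
  field
    0≉1     : ¬ (0# ≈ 1#)
    inverse : ∀ x → ¬ (x ≈ 0#) → Σ Carrier λ y → (x * y) ≈ 1#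

-- Simple graphs on vertex set Fin n (vertex v_i is i).

record SimpleGraph (n : ℕ) : Set₁ where
  field
    Adj     : Fin n → Fin n → Set
    symm    : ∀ {i j} → Adj i j → Adj j i
    irrefl  : ∀ {i} → ¬ Adj i i

data Reach {n : ℕ} (G : SimpleGraph n) : Fin n → Fin n → Set where
  here : ∀ {i} → Reach G i i
  step : ∀ {i j k} → SimpleGraph.Adj G i j → Reach G j k → Reach G i k

Connected : ∀ {n} → SimpleGraph n → Set
Connected {n} G = ∀ (i j : Fin n) → Reach G i j

count : ∀ {n} → Fin n → List (Fin n) → ℕ
count i ω = length (filter (Fin._≟ i) ω)

-- the sequence ω̄: the k-th occurrence (k = 0,1,…) of v_i is replaced by
-- the pair (i , k), which stands for u_{m_1+…+m_{i-1}+k+1}.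
barAux : ∀ {n} → List (Fin n) → List (Fin n) → List (Fin n × ℕ)
barAux seen []      = []
barAux seen (w ∷ ω) = (w , count w seen) ∷ barAux (w ∷ seen) ω

bar : ∀ {n} → List (Fin n) → List (Fin n × ℕ)
bar ω = barAux [] ω

_≟p_ : ∀ {n} (x y : Fin n × ℕ) → Dec (x ≡ y)
(i , k) ≟p (j , l) with i Fin.≟ j | k ℕ.≟ l
... | yes Relation.Binary.PropositionalEquality.refl | yes Relation.Binary.PropositionalEquality.refl = yes Relation.Binary.PropositionalEquality.refl
... | no i≢j | _ = no λ { Relation.Binary.PropositionalEquality.refl → i≢j Relation.Binary.PropositionalEquality.refl }
... | yes _ | no k≢l = no λ { Relation.Binary.PropositionalEquality.refl → k≢l Relation.Binary.PropositionalEquality.refl }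

elem : ∀ {n} → Fin n × ℕ → List (Fin n × ℕ) → Bool
elem x []       = false
elem x (y ∷ ys) = if does (x ≟p y) then true else elem x ys

-- appearsAfter σ p q = true iff p appears after q in the arrangement σ
-- (elements of σ are pairwise distinct).
appearsAfter : ∀ {n} → List (Fin n × ℕ) → Fin n × ℕ → Fin n × ℕ → Bool
appearsAfter []      p q = false
appearsAfter (x ∷ σ) p q =
  if does (x ≟p q) then elem p σ
  else if does (x ≟p p) then false
  else appearsAfter σ p q

module Matrices {c ℓ} (K : Field c ℓ) where
  open Field K

  Σ[_] : ∀ {n} → (Fin n → Carrier) → Carrier
  Σ[_] {zero}    f = 0#
  Σ[_] {ℕ.suc n} f = f Fin.zero + Σ[ (λ i → f (Fin.suc i)) ]

  Mat : ℕ → Set c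
  Mat n = Fin n → Fin n → Carrier

  _≈M_ : ∀ {n} → Mat n → Mat n → Set ℓ
  M ≈M N = ∀ i j → M i j ≈ N i j

  δ : ∀ {n} → Fin n → Fin n → Carrier
  δ i j = if does (i Fin.≟ j) then 1# else 0#

  I : ∀ {n} → Mat n
  I = δ

  _+M_ _-M_ _*M_ : ∀ {n} → Mat n → Mat n → Mat n
  (M +M N) i j = M i j + N i j
  (M -M N) i j = M i j - N i j
  (M *M N) i j = Σ[ (λ k → M i k * N k j) ]

  F : ∀ {n} → Mat n → Fin n → Mat n
  F A i r c' = if does (r Fin.≟ i) then A r c' else δ r c'

  -- system map (G,A,ω) = F_{w_m} ⋯ F_{w_1}
  sysMap : ∀ {n} → Mat n → List (Fin n) → Mat n
  sysMap A []      = I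
  sysMap A (w ∷ ω) = sysMap A ω *M F A w

  -- m × m matrices with rows/columns indexed by u_1,…,u_m, where u with
  -- index m_1+…+m_{i-1}+k+1 is represented by the pair (i , k), k < m_i.

  Idx : ∀ {n} → (Fin n → ℕ) → Set
  Idx {n} s = Σ (Fin n) λ i → Fin (s i)

  BMat : ∀ {n} → (Fin n → ℕ) → Set c
  BMat s = Idx s → Idx s → Carrier

  ΣIdx : ∀ {n} (s : Fin n → ℕ) → (Idx s → Carrier) → Carrier
  ΣIdx s f = Σ[ (λ i → Σ[ (λ k → f (i , k)) ]) ]

  δB : ∀ {n} {s : Fin n → ℕ} → Idx s → Idx s → Carrier
  δB (i , k) (j , l) =
    if does (i Fin.≟ j) ∧ does (toℕ k ℕ.≟ toℕ l) then 1# else 0#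

  IB : ∀ {n} {s : Fin n → ℕ} → BMat s
  IB = δB

  _-B_ _*B_ : ∀ {n} {s : Fin n → ℕ} → BMat s → BMat s → BMat s
  (M -B N) p q = M p q - N p q
  _*B_ {s = s} M N p q = ΣIdx s (λ r → M p r * N r q)

  _≈B_ : ∀ {n} {s : Fin n → ℕ} → BMat s → BMat s → Set ℓ
  M ≈B N = ∀ p q → M p q ≈ N p q

  expand : ∀ {n} → Mat n → (s : Fin n → ℕ) → BMat s
  expand T s (i , k) (j , l) = T i j

  compress : ∀ {n} (s : Fin n → ℕ) → BMat s → Mat n
  compress s T r l = Σ[ (λ k → Σ[ (λ k' → T (r , k) (l , k')) ]) ]

  restrict : ∀ {n} {s : Fin n → ℕ} → BMat s → List (Fin n × ℕ) → BMat s
  restrict T σ (i , k) (j , l) =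
    if appearsAfter σ (i , toℕ k) (j , toℕ l) then T (i , k) (j , l) else 0#

module Submission where

-- Write C = A - I and let the letter w_t of ω become u_t in
-- the arrangement σ = ω̄.  Since F_v = I + e_v (row v of C), the system map
-- is a product of rank-one updates, (G,A,ω) = (I + e_{w_m} C_{w_m}) ⋯
-- (I + e_{w_1} C_{w_1}), and such a product equals I + U (I - B_σ)⁻¹ V where
-- U, V are the block column/row matrices of labels and B_σ keeps the entry
-- C(w_p, w_q) exactly when u_p comes after u_q in σ.  We prove this for an
-- arbitrary duplicate-free list σ by induction, adjoining the first element
-- x of x ∷ σ: I - B_{x∷σ} is block lower triangular, its inverse M (x ∷ σ)
-- is given explicitly from M σ (block forward substitution), and both
-- inverse identities and the product formula follow by block computations.

open import Defs
open import Level using (Level)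
open import Data.Nat using (ℕ; _≤_)
open import Data.Fin using (Fin)
open import Data.List using (List)
open import Data.Product using (Σ; _×_)
open import Relation.Nullary using (¬_)
open import Relation.Binary.PropositionalEquality using (_≡_)

import Data.Nat as ℕ
import Data.Nat.Properties as ℕP
import Data.Fin as Fin
open import Data.Fin using (toℕ)
import Data.Fin.Properties as FinP
open import Data.List using ([]; _∷_; map; length)
import Data.List.Properties as ListP
open import Data.List.Membership.Propositional using (_∈_)
open import Data.List.Relation.Unary.Any using (here; there)
open import Data.List.Relation.Unary.All as All using (All; []; _∷_)
open import Data.List.Relation.Unary.Unique.Propositional using (Unique; []; _∷_)
open import Data.Product using (_,_; proj₁; proj₂)
open import Data.Bool using (true; false; if_then_else_; _∧_)
open import Relation.Nullary using (Dec; yes; no; does)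
open import Relation.Nullary.Decidable using (dec-true; dec-false)
import Relation.Binary.PropositionalEquality as ≡
open ≡ using (_≢_; cong; cong₂; subst)

module Words {n : ℕ} where
  open ≡ using (refl; sym; trans)

  count-here : ∀ (w : Fin n) ω → count w (w ∷ ω) ≡ ℕ.suc (count w ω)
  count-here w ω = cong length (ListP.filter-accept (Fin._≟ w) {w} {ω} refl)

  count-there : ∀ {w i : Fin n} ω → w ≢ i → count i (w ∷ ω) ≡ count i ω
  count-there {i = i} ω w≢i = cong length (ListP.filter-reject (Fin._≟ i) {xs = ω} w≢i)

  count-≤-∷ : ∀ (i w : Fin n) ω → count i ω ≤ count i (w ∷ ω)
  count-≤-∷ i w ω = by-cases (w Fin.≟ i)
    where
    by-cases : Dec (w ≡ i) → count i ω ≤ count i (w ∷ ω)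
    by-cases (yes refl) = subst (count w ω ≤_) (sym (count-here w ω)) (ℕP.n≤1+n _)
    by-cases (no w≢i)   = ℕP.≤-reflexive (sym (count-there ω w≢i))

  bar-labels : ∀ (seen ω : List (Fin n)) → map proj₁ (barAux seen ω) ≡ ω
  bar-labels seen []      = refl
  bar-labels seen (w ∷ ω) = cong (w ∷_) (bar-labels (w ∷ seen) ω)

  bar-above : ∀ (seen ω : List (Fin n)) →
              All (λ p → count (proj₁ p) seen ≤ proj₂ p) (barAux seen ω)
  bar-above seen []      = []
  bar-above seen (w ∷ ω) =
    ℕP.≤-refl ∷ All.map (λ {p} → ℕP.≤-trans (count-≤-∷ (proj₁ p) w seen))
                        (bar-above (w ∷ seen) ω)

  bar-unique : ∀ (seen ω : List (Fin n)) → Unique (barAux seen ω)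
  bar-unique seen []      = []
  bar-unique seen (w ∷ ω) = All.map fresh (bar-above (w ∷ seen) ω) ∷ bar-unique (w ∷ seen) ω
    where
    fresh : ∀ {p} → count (proj₁ p) (w ∷ seen) ≤ proj₂ p → (w , count w seen) ≢ p
    fresh le refl = ℕP.<-irrefl refl (subst (_≤ count w seen) (count-here w seen) le)

  bar-complete : ∀ (seen ω : List (Fin n)) i k → k ℕ.< count i ω →
                 (i , count i seen ℕ.+ k) ∈ barAux seen ω
  bar-complete seen (w ∷ ω) i k k< = by-cases (w Fin.≟ i) k k<
    where
    by-cases : Dec (w ≡ i) → ∀ k → k ℕ.< count i (w ∷ ω) →
               (i , count i seen ℕ.+ k) ∈ barAux seen (w ∷ ω)
    by-cases (yes refl) ℕ.zero    _  = here (cong (w ,_) (ℕP.+-identityʳ _))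
    by-cases (yes refl) (ℕ.suc k) k< =
      there (subst (λ b → (w , b) ∈ barAux (w ∷ seen) ω) shift
              (bar-complete (w ∷ seen) ω w k
                (ℕ.s≤s⁻¹ (subst (ℕ.suc (ℕ.suc k) ≤_) (count-here w ω) k<))))
      where
      shift : count w (w ∷ seen) ℕ.+ k ≡ count w seen ℕ.+ ℕ.suc k
      shift = trans (cong (ℕ._+ k) (count-here w seen)) (sym (ℕP.+-suc (count w seen) k))
    by-cases (no w≢i) k k< =
      there (subst (λ a → (i , a ℕ.+ k) ∈ barAux (w ∷ seen) ω) (count-there seen w≢i)
              (bar-complete (w ∷ seen) ω i k (subst (ℕ.suc k ≤_) (count-there ω w≢i) k<)))

module Arrangement {n : ℕ} where
  open ≡ using (refl)

  -- a label (i , k) names u_{m_1+…+m_{i-1}+k+1}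
  Label : Set
  Label = Fin n × ℕ

  elem-true : ∀ {p : Label} {σ} → p ∈ σ → elem p σ ≡ true
  elem-true {p} (here refl) rewrite dec-true (p ≟p p) refl = refl
  elem-true {p} {y ∷ σ} (there p∈) with does (p ≟p y)
  ... | true  = refl
  ... | false = elem-true p∈

  elem-false : ∀ {p : Label} {σ} → All (p ≢_) σ → elem p σ ≡ false
  elem-false []                         = refl
  elem-false {p} {y ∷ σ} (p≢y ∷ p∉) rewrite dec-false (p ≟p y) p≢y = elem-false p∉

module LinearAlgebra {c ℓ} (K : Field c ℓ) where
  open Field K
  open Matrices K
  open import Algebra.Properties.Ring ring using (-‿distribʳ-*; -0#≈0#; -‿+-comm)
  open import Algebra.Properties.Semiring.Sum semiring
    using (sum; sum-cong-≋; sum-cong-≗; sum-replicate-zero; ∑-distrib-+; ∑-comm;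
           *-distribˡ-sum; *-distribʳ-sum)
  open import Algebra.Solver.CommutativeMonoid +-commutativeMonoid
    using (solve; _⊕_; _⊜_)
  open import Relation.Binary.Reasoning.Setoid setoid

  Σ≡sum : ∀ {m} (f : Fin m → Carrier) → Σ[ f ] ≡ sum f
  Σ≡sum {ℕ.zero}  f = ≡.refl
  Σ≡sum {ℕ.suc m} f = cong (f Fin.zero +_) (Σ≡sum (λ i → f (Fin.suc i)))

  ΣIdx≡sum : ∀ {n} (s : Fin n → ℕ) (f : Idx s → Carrier) →
             ΣIdx s f ≡ sum (λ i → sum (λ k → f (i , k)))
  ΣIdx≡sum s f = ≡.trans (Σ≡sum (λ i → Σ[ (λ k → f (i , k)) ]))
                         (sum-cong-≗ (λ i → Σ≡sum (λ k → f (i , k))))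

  sum-zero : ∀ {m} {f : Fin m → Carrier} → (∀ k → f k ≈ 0#) → sum f ≈ 0#
  sum-zero {m} f≈0 = trans (sum-cong-≋ f≈0) (sum-replicate-zero m)

  δ-diag : ∀ {m} (i : Fin m) → δ i i ≈ 1#
  δ-diag i = reflexive (cong (λ b → if b then 1# else 0#) (dec-true (i Fin.≟ i) ≡.refl))

  δ-off : ∀ {m} {i j : Fin m} → i ≢ j → δ i j ≈ 0#
  δ-off {i = i} {j} i≢j =
    reflexive (cong (λ b → if b then 1# else 0#) (dec-false (i Fin.≟ j) i≢j))

  sum-δˡ : ∀ {m} (r : Fin m) (X : Fin m → Carrier) → sum (λ k → δ r k * X k) ≈ X r
  sum-δˡ {ℕ.suc m} Fin.zero X =
    trans (+-cong (*-identityˡ _) (sum-zero (λ k → zeroˡ (X (Fin.suc k)))))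
          (+-identityʳ _)
  sum-δˡ {ℕ.suc m} (Fin.suc r) X =
    trans (+-cong (zeroˡ _) (sum-δˡ r (λ k → X (Fin.suc k)))) (+-identityˡ _)

  sum-δʳ : ∀ {m} (r : Fin m) (X : Fin m → Carrier) → sum (λ k → X k * δ k r) ≈ X r
  sum-δʳ {ℕ.suc m} Fin.zero X =
    trans (+-cong (*-identityʳ _) (sum-zero (λ k → zeroʳ (X (Fin.suc k)))))
          (+-identityʳ _)
  sum-δʳ {ℕ.suc m} (Fin.suc r) X =
    trans (+-cong (zeroʳ _) (sum-δʳ r (λ k → X (Fin.suc k)))) (+-identityˡ _)

  sub-zero : ∀ {a b} → b ≈ 0# → a - b ≈ a
  sub-zero {a} b≈0 = trans (+-congˡ (trans (-‿cong b≈0) -0#≈0#)) (+-identityʳ a)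

  add-diff : ∀ a b → a + (b - a) ≈ b
  add-diff a b = trans (+-comm a (b - a)) (trans (+-assoc b (- a) a)
                   (trans (+-congˡ (-‿inverseˡ a)) (+-identityʳ b)))

  compress-* : ∀ {n} (s : Fin n → ℕ) (T : BMat s) (V : Mat n) r c →
               (compress s T *M V) r c ≈ sum (λ k → ΣIdx s (λ q → T (r , k) q * V (proj₁ q) c))
  compress-* s T V r c = begin
    Σ[ (λ l → compress s T r l * V l c) ]
      ≡⟨ ≡.trans (Σ≡sum (λ l → compress s T r l * V l c))
                 (sum-cong-≗ (λ l → cong (_* V l c) (compress≡sum l))) ⟩
    sum (λ l → sum (λ k → sum (λ k′ → T (r , k) (l , k′))) * V l c)
      ≈⟨ sum-cong-≋ (λ l →
           trans (*-distribʳ-sum (V l c) (λ k → sum (λ k′ → T (r , k) (l , k′))))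
                 (sum-cong-≋ (λ k → *-distribʳ-sum (V l c) (λ k′ → T (r , k) (l , k′))))) ⟩
    sum (λ l → sum (λ k → sum (λ k′ → T (r , k) (l , k′) * V l c)))
      ≈⟨ ∑-comm (λ l k → sum (λ k′ → T (r , k) (l , k′) * V l c)) ⟩
    sum (λ k → sum (λ l → sum (λ k′ → T (r , k) (l , k′) * V l c)))
      ≡⟨ sum-cong-≗ (λ k → ΣIdx≡sum s (λ q → T (r , k) q * V (proj₁ q) c)) ⟨
    sum (λ k → ΣIdx s (λ q → T (r , k) q * V (proj₁ q) c)) ∎
    where
    compress≡sum : ∀ l → compress s T r l ≡ sum (λ k → sum (λ k′ → T (r , k) (l , k′)))
    compress≡sum l = ≡.trans (Σ≡sum (λ k → Σ[ (λ k′ → T (r , k) (l , k′)) ]))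
                             (sum-cong-≗ (λ k → Σ≡sum (λ k′ → T (r , k) (l , k′))))

  row-select : ∀ {n} (s : Fin n → ℕ) r (g : Idx s → Carrier) →
               ΣIdx s (λ p → δ r (proj₁ p) * g p) ≈ sum (λ k → g (r , k))
  row-select s r g = begin
    ΣIdx s (λ p → δ r (proj₁ p) * g p)
      ≡⟨ ΣIdx≡sum s (λ p → δ r (proj₁ p) * g p) ⟩
    sum (λ i → sum (λ k → δ r i * g (i , k)))
      ≈⟨ sum-cong-≋ (λ i → sym (*-distribˡ-sum (δ r i) (λ k → g (i , k)))) ⟩
    sum (λ i → δ r i * sum (λ k → g (i , k)))
      ≈⟨ sum-δˡ r (λ i → sum (λ k → g (i , k))) ⟩
    sum (λ k → g (r , k)) ∎

  sumOver : ∀ {X : Set} → List X → (X → Carrier) → Carrier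
  sumOver []      f = 0#
  sumOver (x ∷ σ) f = f x + sumOver σ f

  module _ {X : Set} where

    sumOver-cong : ∀ (σ : List X) {f g : X → Carrier} →
                   (∀ {r} → r ∈ σ → f r ≈ g r) → sumOver σ f ≈ sumOver σ g
    sumOver-cong []      f≈g = refl
    sumOver-cong (x ∷ σ) f≈g =
      +-cong (f≈g (here ≡.refl)) (sumOver-cong σ (λ r∈ → f≈g (there r∈)))

    sumOver-zero : ∀ (σ : List X) {f : X → Carrier} →
                   (∀ {r} → r ∈ σ → f r ≈ 0#) → sumOver σ f ≈ 0#
    sumOver-zero []      f≈0 = refl
    sumOver-zero (x ∷ σ) f≈0 =
      trans (+-cong (f≈0 (here ≡.refl)) (sumOver-zero σ (λ r∈ → f≈0 (there r∈))))
            (+-identityˡ 0#)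

    sumOver-+ : ∀ (σ : List X) (f g : X → Carrier) →
                sumOver σ (λ r → f r + g r) ≈ sumOver σ f + sumOver σ g
    sumOver-+ []      f g = sym (+-identityˡ 0#)
    sumOver-+ (x ∷ σ) f g =
      trans (+-congˡ (sumOver-+ σ f g))
            (solve 4 (λ a b c d → (a ⊕ b) ⊕ (c ⊕ d) ⊜ (a ⊕ c) ⊕ (b ⊕ d)) refl _ _ _ _)

    sumOver-*ˡ : ∀ (σ : List X) a (f : X → Carrier) → sumOver σ (λ r → a * f r) ≈ a * sumOver σ f
    sumOver-*ˡ []      a f = sym (zeroʳ a)
    sumOver-*ˡ (x ∷ σ) a f = trans (+-congˡ (sumOver-*ˡ σ a f)) (sym (distribˡ a _ _))

    sumOver-*ʳ : ∀ (σ : List X) a (f : X → Carrier) → sumOver σ (λ r → f r * a) ≈ sumOver σ f * a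
    sumOver-*ʳ []      a f = sym (zeroˡ a)
    sumOver-*ʳ (x ∷ σ) a f = trans (+-congˡ (sumOver-*ʳ σ a f)) (sym (distribʳ a _ _))

    sumOver-neg : ∀ (σ : List X) (f : X → Carrier) → sumOver σ (λ r → - f r) ≈ - sumOver σ f
    sumOver-neg []      f = sym -0#≈0#
    sumOver-neg (x ∷ σ) f = trans (+-congˡ (sumOver-neg σ f)) (-‿+-comm _ _)

    sumOver-comm : ∀ (σ τ : List X) (f : X → X → Carrier) →
                   sumOver σ (λ r → sumOver τ (f r)) ≈ sumOver τ (λ t → sumOver σ (λ r → f r t))
    sumOver-comm []      τ f = sym (sumOver-zero τ (λ _ → refl))
    sumOver-comm (x ∷ σ) τ f =
      trans (+-congˡ (sumOver-comm σ τ f)) (sym (sumOver-+ τ (f x) (λ t → sumOver σ (λ r → f r t))))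

  -- Summing over u_1,…,u_m (the index set Idx s) is summing over the
  -- arrangement ω̄, since ω̄ lists each u exactly once.
  module Transfer {n : ℕ} where
    open Words {n}
    open Arrangement {n}

    occurrences : (Label → Carrier) → List (Fin n) → List (Fin n) → Fin n → Carrier
    occurrences f seen ω i = sum (λ (k : Fin (count i ω)) → f (i , count i seen ℕ.+ toℕ k))

    occurrences-∷ : ∀ f seen w ω i →
      occurrences f seen (w ∷ ω) i ≈ δ w i * f (w , count w seen) + occurrences f (w ∷ seen) ω i
    occurrences-∷ f seen w ω i = by-cases (w Fin.≟ i)
      where
      by-cases : Dec (w ≡ i) →
        occurrences f seen (w ∷ ω) i ≈ δ w i * f (w , count w seen) + occurrences f (w ∷ seen) ω i
      by-cases (yes ≡.refl) rewrite count-here w ω | count-here w seen =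
        +-cong (trans (reflexive (cong (λ b → f (w , b)) (ℕP.+-identityʳ _)))
                      (sym (trans (*-congʳ (δ-diag w)) (*-identityˡ _))))
               (reflexive (sum-cong-≗ {count w ω}
                 (λ k → cong (λ b → f (w , b)) (ℕP.+-suc (count w seen) (toℕ k)))))
      by-cases (no w≢i) rewrite count-there ω w≢i | count-there seen w≢i =
        sym (trans (+-congʳ (trans (*-congʳ (δ-off w≢i)) (zeroˡ _))) (+-identityˡ _))

    transfer-from : ∀ (f : Label → Carrier) seen ω →
                    sum (occurrences f seen ω) ≈ sumOver (barAux seen ω) f
    transfer-from f seen []      = sum-replicate-zero n
    transfer-from f seen (w ∷ ω) = begin
      sum (occurrences f seen (w ∷ ω))
        ≈⟨ sum-cong-≋ (occurrences-∷ f seen w ω) ⟩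
      sum (λ i → δ w i * f (w , count w seen) + occurrences f (w ∷ seen) ω i)
        ≈⟨ ∑-distrib-+ (λ i → δ w i * f (w , count w seen)) (occurrences f (w ∷ seen) ω) ⟩
      sum (λ i → δ w i * f (w , count w seen)) + sum (occurrences f (w ∷ seen) ω)
        ≈⟨ +-cong (sum-δˡ w (λ _ → f (w , count w seen))) (transfer-from f (w ∷ seen) ω) ⟩
      f (w , count w seen) + sumOver (barAux (w ∷ seen) ω) f ∎

    label : ∀ {s : Fin n → ℕ} → Idx s → Label
    label (i , k) = (i , toℕ k)

    transfer : ∀ ω (f : Label → Carrier) →
               ΣIdx (λ i → count i ω) (λ p → f (label p)) ≈ sumOver (bar ω) f
    transfer ω f = trans (reflexive (ΣIdx≡sum (λ i → count i ω) (λ p → f (label p))))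
                         (transfer-from f [] ω)

  module LabelMatrices {n : ℕ} where
    open Arrangement {n}

    δu : Label → Label → Carrier
    δu p q = if does (proj₁ p Fin.≟ proj₁ q) ∧ does (proj₂ p ℕ.≟ proj₂ q) then 1# else 0#

    δu-diag : ∀ p → δu p p ≈ 1#
    δu-diag (i , a) = reflexive (cong (λ b → if b then 1# else 0#)
      (cong₂ _∧_ (dec-true (i Fin.≟ i) ≡.refl) (dec-true (a ℕ.≟ a) ≡.refl)))

    δu-off : ∀ {p q} → p ≢ q → δu p q ≈ 0#
    δu-off {i , a} {j , b} p≢q with i Fin.≟ j
    ... | no _        = refl
    ... | yes ≡.refl  = reflexive (cong (λ z → if z then 1# else 0#)
                          (cong (true ∧_) (dec-false (a ℕ.≟ b) (λ a≡b → p≢q (cong (i ,_) a≡b)))))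

    sumOver-δu : ∀ {σ} → Unique σ → ∀ {p} → p ∈ σ → (g : Label → Carrier) →
                 sumOver σ (λ r → δu p r * g r) ≈ g p
    sumOver-δu {x ∷ σ} (x∉ ∷ _) (here ≡.refl) g =
      trans (+-cong (trans (*-congʳ (δu-diag x)) (*-identityˡ _))
                    (sumOver-zero σ (λ r∈ → trans (*-congʳ (δu-off (All.lookup x∉ r∈))) (zeroˡ _))))
            (+-identityʳ _)
    sumOver-δu {x ∷ σ} (x∉ ∷ u) (there p∈) g =
      trans (+-cong (trans (*-congʳ (δu-off (λ p≡x → All.lookup x∉ p∈ (≡.sym p≡x)))) (zeroˡ _))
                    (sumOver-δu u p∈ g))
            (+-identityˡ _)

    -- a row that meets X like the p-th row of the identity meets X V like V:
    -- associativity of the product row · X · V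
    row-inverse : ∀ {σ} → Unique σ → ∀ {p} → p ∈ σ →
                  (row : Label → Carrier) (X : Label → Label → Carrier) (V : Label → Carrier) →
                  (∀ {q} → q ∈ σ → sumOver σ (λ r → row r * X r q) ≈ δu p q) →
                  sumOver σ (λ r → row r * sumOver σ (λ q → X r q * V q)) ≈ V p
    row-inverse {σ} u {p} p∈ row X V row·X≈δ = begin
      sumOver σ (λ r → row r * sumOver σ (λ q → X r q * V q))
        ≈⟨ sumOver-cong σ (λ {r} _ → sym (sumOver-*ˡ σ (row r) (λ q → X r q * V q))) ⟩
      sumOver σ (λ r → sumOver σ (λ q → row r * (X r q * V q)))
        ≈⟨ sumOver-comm σ σ (λ r q → row r * (X r q * V q)) ⟩
      sumOver σ (λ q → sumOver σ (λ r → row r * (X r q * V q)))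
        ≈⟨ sumOver-cong σ (λ {q} _ →
             sumOver-cong σ (λ {r} _ → sym (*-assoc (row r) (X r q) (V q)))) ⟩
      sumOver σ (λ q → sumOver σ (λ r → (row r * X r q) * V q))
        ≈⟨ sumOver-cong σ (λ {q} _ → sumOver-*ʳ σ (V q) (λ r → row r * X r q)) ⟩
      sumOver σ (λ q → sumOver σ (λ r → row r * X r q) * V q)
        ≈⟨ sumOver-cong σ (λ q∈ → *-congʳ (row·X≈δ q∈)) ⟩
      sumOver σ (λ q → δu p q * V q)
        ≈⟨ sumOver-δu u p∈ V ⟩
      V p ∎

  -- With
  -- C = A - I, the matrix B_σ has entry C(i, j) at labels p = (i , k),
  -- q = (j , l) when p comes after q in σ and 0 otherwise, so I - B_σ is
  -- unitriangular; its inverse M σ is built by adjoining the first element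
  -- of σ as a new first row and column.
  module Triangular {n : ℕ} (A : Mat n) where
    open Arrangement {n}
    open LabelMatrices {n}

    C : Mat n
    C = A -M I

    N : List Label → Label → Label → Carrier
    N σ p q = if appearsAfter σ p q then C (proj₁ p) (proj₁ q) else 0#

    L : List Label → Label → Label → Carrier
    L σ p q = δu p q - N σ p q

    -- M σ = (I - B_σ)⁻¹, and Y σ = M σ V with V_{(j , l) c} = C j c
    M : List Label → Label → Label → Carrier
    Y : List Label → Label → Fin n → Carrier

    M []      p q = 0#
    M (x ∷ σ) p q =
      if does (x ≟p q)
      then (if does (x ≟p p) then 1# else Y σ p (proj₁ x))
      else (if does (x ≟p p) then 0# else M σ p q)

    Y σ p c = sumOver σ (λ q → M σ p q * C (proj₁ q) c)

    -- Block structure of M and B over x ∷ σ: the first element x comes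
    -- after nothing, and everything in σ comes after x.
    M-corner : ∀ x σ → M (x ∷ σ) x x ≡ 1#
    M-corner x σ rewrite dec-true (x ≟p x) ≡.refl = ≡.refl

    M-top : ∀ x σ {q} → x ≢ q → M (x ∷ σ) x q ≡ 0#
    M-top x σ {q} x≢q rewrite dec-false (x ≟p q) x≢q | dec-true (x ≟p x) ≡.refl = ≡.refl

    M-left : ∀ x σ {p} → x ≢ p → M (x ∷ σ) p x ≡ Y σ p (proj₁ x)
    M-left x σ {p} x≢p rewrite dec-true (x ≟p x) ≡.refl | dec-false (x ≟p p) x≢p = ≡.refl

    M-rest : ∀ x σ {p q} → x ≢ p → x ≢ q → M (x ∷ σ) p q ≡ M σ p q
    M-rest x σ {p} {q} x≢p x≢q rewrite dec-false (x ≟p q) x≢q | dec-false (x ≟p p) x≢p = ≡.refl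

    N-top : ∀ x σ q → All (x ≢_) σ → N (x ∷ σ) x q ≡ 0#
    N-top x σ q x∉ with does (x ≟p q)
    ... | true  rewrite elem-false x∉ = ≡.refl
    ... | false rewrite dec-true (x ≟p x) ≡.refl = ≡.refl

    N-left : ∀ x σ {p} → p ∈ σ → N (x ∷ σ) p x ≡ C (proj₁ p) (proj₁ x)
    N-left x σ p∈ rewrite dec-true (x ≟p x) ≡.refl | elem-true p∈ = ≡.refl

    N-rest : ∀ x σ {p q} → x ≢ p → x ≢ q → N (x ∷ σ) p q ≡ N σ p q
    N-rest x σ {p} {q} x≢p x≢q rewrite dec-false (x ≟p q) x≢q | dec-false (x ≟p p) x≢p = ≡.refl

    L-top : ∀ x σ q → All (x ≢_) σ → L (x ∷ σ) x q ≈ δu x q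
    L-top x σ q x∉ = sub-zero (reflexive (N-top x σ q x∉))

    L-left : ∀ x σ {p} → p ∈ σ → x ≢ p → L (x ∷ σ) p x ≈ - C (proj₁ p) (proj₁ x)
    L-left x σ p∈ x≢p =
      trans (+-cong (δu-off (λ p≡x → x≢p (≡.sym p≡x))) (-‿cong (reflexive (N-left x σ p∈))))
            (+-identityˡ _)

    L-rest : ∀ x σ {p q} → x ≢ p → x ≢ q → L (x ∷ σ) p q ≡ L σ p q
    L-rest x σ {p} {q} x≢p x≢q = cong (λ z → δu p q - z) (N-rest x σ x≢p x≢q)

    M-first-row : ∀ x σ {q} → All (x ≢_) σ → q ∈ x ∷ σ → M (x ∷ σ) x q ≈ δu x q
    M-first-row x σ x∉ (here ≡.refl) = trans (reflexive (M-corner x σ)) (sym (δu-diag x))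
    M-first-row x σ x∉ (there q∈)    =
      trans (reflexive (M-top x σ (All.lookup x∉ q∈))) (sym (δu-off (All.lookup x∉ q∈)))

    M-top-sum : ∀ x σ → All (x ≢_) σ → (g : Label → Carrier) →
                sumOver σ (λ r → M (x ∷ σ) x r * g r) ≈ 0#
    M-top-sum x σ x∉ g =
      sumOver-zero σ (λ r∈ → trans (*-congʳ (reflexive (M-top x σ (All.lookup x∉ r∈)))) (zeroˡ _))

    M-inverseˡ : ∀ {σ} → Unique σ → ∀ {p q} → p ∈ σ → q ∈ σ →
                 sumOver σ (λ r → L σ p r * M σ r q) ≈ δu p q
    M-inverseˡ {x ∷ σ} (x∉ ∷ u) {q = q} (here ≡.refl) q∈ = begin
      sumOver (x ∷ σ) (λ r → L (x ∷ σ) x r * M (x ∷ σ) r q)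
        ≈⟨ sumOver-cong (x ∷ σ) (λ {r} _ → *-congʳ (L-top x σ r x∉)) ⟩
      sumOver (x ∷ σ) (λ r → δu x r * M (x ∷ σ) r q)
        ≈⟨ sumOver-δu (x∉ ∷ u) (here ≡.refl) (λ r → M (x ∷ σ) r q) ⟩
      M (x ∷ σ) x q
        ≈⟨ M-first-row x σ x∉ q∈ ⟩
      δu x q ∎
    M-inverseˡ {x ∷ σ} (x∉ ∷ u) {p} (there p∈) (here ≡.refl) = begin
      L (x ∷ σ) p x * M (x ∷ σ) x x + sumOver σ (λ r → L (x ∷ σ) p r * M (x ∷ σ) r x)
        ≈⟨ +-cong (*-cong (L-left x σ p∈ x≢p) (reflexive (M-corner x σ)))
                  (sumOver-cong σ (λ r∈ → *-cong (reflexive (L-rest x σ x≢p (All.lookup x∉ r∈)))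
                                                 (reflexive (M-left x σ (All.lookup x∉ r∈))))) ⟩
      - C (proj₁ p) (proj₁ x) * 1# + sumOver σ (λ r → L σ p r * Y σ r (proj₁ x))
        ≈⟨ +-cong (*-identityʳ _)
                  (row-inverse u p∈ (L σ p) (M σ) (λ q → C (proj₁ q) (proj₁ x)) (M-inverseˡ u p∈)) ⟩
      - C (proj₁ p) (proj₁ x) + C (proj₁ p) (proj₁ x)
        ≈⟨ -‿inverseˡ _ ⟩
      0#
        ≈⟨ δu-off (λ p≡x → x≢p (≡.sym p≡x)) ⟨
      δu p x ∎
      where x≢p = All.lookup x∉ p∈
    M-inverseˡ {x ∷ σ} (x∉ ∷ u) {p} {q} (there p∈) (there q∈) = begin
      L (x ∷ σ) p x * M (x ∷ σ) x q + sumOver σ (λ r → L (x ∷ σ) p r * M (x ∷ σ) r q)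
        ≈⟨ +-cong (*-congˡ (reflexive (M-top x σ (All.lookup x∉ q∈))))
                  (sumOver-cong σ (λ r∈ → *-cong (reflexive (L-rest x σ (All.lookup x∉ p∈) (All.lookup x∉ r∈)))
                                                 (reflexive (M-rest x σ (All.lookup x∉ r∈) (All.lookup x∉ q∈))))) ⟩
      L (x ∷ σ) p x * 0# + sumOver σ (λ r → L σ p r * M σ r q)
        ≈⟨ +-cong (zeroʳ _) (M-inverseˡ u p∈ q∈) ⟩
      0# + δu p q
        ≈⟨ +-identityˡ _ ⟩
      δu p q ∎

    M-inverseʳ : ∀ {σ} → Unique σ → ∀ {p q} → p ∈ σ → q ∈ σ →
                 sumOver σ (λ r → M σ p r * L σ r q) ≈ δu p q
    M-inverseʳ {x ∷ σ} (x∉ ∷ u) (here ≡.refl) (here ≡.refl) = begin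
      M (x ∷ σ) x x * L (x ∷ σ) x x + sumOver σ (λ r → M (x ∷ σ) x r * L (x ∷ σ) r x)
        ≈⟨ +-cong (*-cong (reflexive (M-corner x σ)) (trans (L-top x σ x x∉) (δu-diag x)))
                  (M-top-sum x σ x∉ (λ r → L (x ∷ σ) r x)) ⟩
      1# * 1# + 0#
        ≈⟨ trans (+-identityʳ _) (*-identityˡ 1#) ⟩
      1#
        ≈⟨ δu-diag x ⟨
      δu x x ∎
    M-inverseʳ {x ∷ σ} (x∉ ∷ u) {p} (there p∈) (here ≡.refl) = begin
      M (x ∷ σ) p x * L (x ∷ σ) x x + sumOver σ (λ r → M (x ∷ σ) p r * L (x ∷ σ) r x)
        ≈⟨ +-cong (*-cong (reflexive (M-left x σ x≢p)) (trans (L-top x σ x x∉) (δu-diag x)))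
                  (sumOver-cong σ (λ r∈ → *-cong (reflexive (M-rest x σ x≢p (All.lookup x∉ r∈)))
                                                 (L-left x σ r∈ (All.lookup x∉ r∈)))) ⟩
      Y σ p (proj₁ x) * 1# + sumOver σ (λ r → M σ p r * - C (proj₁ r) (proj₁ x))
        ≈⟨ +-cong (*-identityʳ _)
                  (trans (sumOver-cong σ (λ {r} _ → sym (-‿distribʳ-* (M σ p r) (C (proj₁ r) (proj₁ x)))))
                         (sumOver-neg σ (λ r → M σ p r * C (proj₁ r) (proj₁ x)))) ⟩
      Y σ p (proj₁ x) - Y σ p (proj₁ x)
        ≈⟨ -‿inverseʳ _ ⟩
      0#
        ≈⟨ δu-off (λ p≡x → x≢p (≡.sym p≡x)) ⟨
      δu p x ∎
      where x≢p = All.lookup x∉ p∈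
    M-inverseʳ {x ∷ σ} (x∉ ∷ u) {p} {q} p∈ (there q∈) = begin
      M (x ∷ σ) p x * L (x ∷ σ) x q + sumOver σ (λ r → M (x ∷ σ) p r * L (x ∷ σ) r q)
        ≈⟨ +-cong (trans (*-congˡ (trans (L-top x σ q x∉) (δu-off x≢q))) (zeroʳ _)) refl ⟩
      0# + sumOver σ (λ r → M (x ∷ σ) p r * L (x ∷ σ) r q)
        ≈⟨ trans (+-identityˡ _) (rest p∈) ⟩
      δu p q ∎
      where
      x≢q = All.lookup x∉ q∈
      rest : ∀ {p} → p ∈ x ∷ σ → sumOver σ (λ r → M (x ∷ σ) p r * L (x ∷ σ) r q) ≈ δu p q
      rest (here ≡.refl) =
        trans (M-top-sum x σ x∉ (λ r → L (x ∷ σ) r q)) (sym (δu-off x≢q))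
      rest (there p∈) =
        trans (sumOver-cong σ (λ r∈ → *-cong (reflexive (M-rest x σ (All.lookup x∉ p∈) (All.lookup x∉ r∈)))
                                             (reflexive (L-rest x σ (All.lookup x∉ r∈) x≢q))))
              (M-inverseʳ u p∈ q∈)

    Y-head : ∀ x σ c → All (x ≢_) σ → Y (x ∷ σ) x c ≈ C (proj₁ x) c
    Y-head x σ c x∉ =
      trans (+-cong (trans (*-congʳ (reflexive (M-corner x σ))) (*-identityˡ _))
                    (M-top-sum x σ x∉ (λ q → C (proj₁ q) c)))
            (+-identityʳ _)

    Y-tail : ∀ x σ c {p} → All (x ≢_) σ → p ∈ σ →
             Y (x ∷ σ) p c ≈ Y σ p c + Y σ p (proj₁ x) * C (proj₁ x) c
    Y-tail x σ c x∉ p∈ =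
      trans (+-cong (*-congʳ (reflexive (M-left x σ x≢p)))
                    (sumOver-cong σ (λ q∈ → *-congʳ (reflexive (M-rest x σ x≢p (All.lookup x∉ q∈))))))
            (+-comm _ _)
      where x≢p = All.lookup x∉ p∈

    F-decomposition : ∀ w k c → F A w k c ≈ δ k c + δ k w * C w c
    F-decomposition w k c with k Fin.≟ w
    ... | yes ≡.refl = sym (trans (+-congˡ (*-identityˡ _)) (add-diff (δ w c) (A w c)))
    ... | no _       = sym (trans (+-congˡ (zeroˡ _)) (+-identityʳ _))

    sysMap-step : ∀ w ω r c →
                  sysMap A (w ∷ ω) r c ≈ sysMap A ω r c + sysMap A ω r w * C w c
    sysMap-step w ω r c = begin
      Σ[ (λ k → S r k * F A w k c) ]
        ≡⟨ Σ≡sum (λ k → S r k * F A w k c) ⟩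
      sum (λ k → S r k * F A w k c)
        ≈⟨ sum-cong-≋ (λ k → trans (*-congˡ (F-decomposition w k c))
                                   (trans (distribˡ (S r k) _ _) (+-congˡ (sym (*-assoc (S r k) _ _))))) ⟩
      sum (λ k → S r k * δ k c + (S r k * δ k w) * C w c)
        ≈⟨ ∑-distrib-+ (λ k → S r k * δ k c) (λ k → (S r k * δ k w) * C w c) ⟩
      sum (λ k → S r k * δ k c) + sum (λ k → (S r k * δ k w) * C w c)
        ≈⟨ +-congˡ (sym (*-distribʳ-sum (C w c) (λ k → S r k * δ k w))) ⟩
      sum (λ k → S r k * δ k c) + sum (λ k → S r k * δ k w) * C w c
        ≈⟨ +-cong (sum-δʳ c (S r)) (*-congʳ (sum-δʳ w (S r))) ⟩
      S r c + S r w * C w c ∎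
      where S = sysMap A ω

    sysMap-formula : ∀ {σ} → Unique σ → ∀ r c →
      sysMap A (map proj₁ σ) r c ≈ δ r c + sumOver σ (λ p → δ r (proj₁ p) * Y σ p c)
    sysMap-formula {[]}    []         r c = sym (+-identityʳ _)
    sysMap-formula {x ∷ σ} (x∉ ∷ u) r c = begin
      sysMap A (w ∷ map proj₁ σ) r c
        ≈⟨ sysMap-step w (map proj₁ σ) r c ⟩
      sysMap A (map proj₁ σ) r c + sysMap A (map proj₁ σ) r w * C w c
        ≈⟨ +-cong (sysMap-formula u r c) (*-congʳ (sysMap-formula u r w)) ⟩
      (δ r c + UY c) + (δ r w + UY w) * C w c
        ≈⟨ +-congˡ (distribʳ (C w c) (δ r w) (UY w)) ⟩
      (δ r c + UY c) + (δ r w * C w c + UY w * C w c)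
        ≈⟨ solve 4 (λ a b d e → (a ⊕ b) ⊕ (d ⊕ e) ⊜ a ⊕ (d ⊕ (b ⊕ e))) refl _ _ _ _ ⟩
      δ r c + (δ r w * C w c + (UY c + UY w * C w c))
        ≈⟨ +-congˡ (+-cong (*-congˡ (sym (Y-head x σ c x∉))) (sym new-rows)) ⟩
      δ r c + (δ r w * Y (x ∷ σ) x c + sumOver σ (λ p → δ r (proj₁ p) * Y (x ∷ σ) p c)) ∎
      where
      w = proj₁ x
      UY : Fin n → Carrier
      UY e = sumOver σ (λ p → δ r (proj₁ p) * Y σ p e)
      new-rows : sumOver σ (λ p → δ r (proj₁ p) * Y (x ∷ σ) p c) ≈ UY c + UY w * C w c
      new-rows = begin
        sumOver σ (λ p → δ r (proj₁ p) * Y (x ∷ σ) p c)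
          ≈⟨ sumOver-cong σ (λ {p} p∈ → trans (*-congˡ (Y-tail x σ c x∉ p∈))
                (trans (distribˡ (δ r (proj₁ p)) _ _) (+-congˡ (sym (*-assoc (δ r (proj₁ p)) _ _))))) ⟩
        sumOver σ (λ p → δ r (proj₁ p) * Y σ p c + (δ r (proj₁ p) * Y σ p w) * C w c)
          ≈⟨ sumOver-+ σ _ _ ⟩
        UY c + sumOver σ (λ p → (δ r (proj₁ p) * Y σ p w) * C w c)
          ≈⟨ +-congˡ (sumOver-*ʳ σ (C w c) (λ p → δ r (proj₁ p) * Y σ p w)) ⟩
        UY c + UY w * C w c ∎

  module WordSystem {n : ℕ} (A : Mat n) (ω : List (Fin n)) where
    open Words {n}
    open Arrangement {n}
    open Transfer {n}
    open Triangular A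

    s : Fin n → ℕ
    s i = count i ω

    σ : List Label
    σ = bar ω

    σ-unique : Unique σ
    σ-unique = bar-unique [] ω

    label∈σ : ∀ (p : Idx s) → label p ∈ σ
    label∈σ (i , k) = bar-complete [] ω i (toℕ k) (FinP.toℕ<n k)

    Mω : BMat s
    Mω p q = M σ (label p) (label q)

    Mω-inverseˡ : ((IB -B restrict (expand (A -M I) s) σ) *B Mω) ≈B IB
    Mω-inverseˡ p q = trans (transfer ω (λ r → L σ (label p) r * M σ r (label q)))
                            (M-inverseˡ σ-unique (label∈σ p) (label∈σ q))

    Mω-inverseʳ : (Mω *B (IB -B restrict (expand (A -M I) s) σ)) ≈B IB
    Mω-inverseʳ p q = trans (transfer ω (λ r → M σ (label p) r * L σ r (label q)))
                            (M-inverseʳ σ-unique (label∈σ p) (label∈σ q))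

    sysMap-compressed : sysMap A ω ≈M (I +M (compress s Mω *M (A -M I)))
    sysMap-compressed r c = begin
      sysMap A ω r c
        ≡⟨ cong (λ ω′ → sysMap A ω′ r c) (bar-labels [] ω) ⟨
      sysMap A (map proj₁ σ) r c
        ≈⟨ sysMap-formula σ-unique r c ⟩
      δ r c + sumOver σ (λ p → δ r (proj₁ p) * Y σ p c)
        ≈⟨ +-congˡ (transfer ω (λ p → δ r (proj₁ p) * Y σ p c)) ⟨
      δ r c + ΣIdx s (λ p → δ r (proj₁ p) * Y σ (label p) c)
        ≈⟨ +-congˡ (row-select s r (λ p → Y σ (label p) c)) ⟩
      δ r c + sum (λ (k : Fin (s r)) → Y σ (r , toℕ k) c)
        ≈⟨ +-congˡ (sum-cong-≋ {s r} (λ k → transfer ω (λ q → M σ (r , toℕ k) q * C (proj₁ q) c))) ⟨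
      δ r c + sum (λ (k : Fin (s r)) → ΣIdx s (λ q → Mω (r , k) q * C (proj₁ q) c))
        ≈⟨ +-congˡ (compress-* s Mω C r c) ⟨
      δ r c + (compress s Mω *M C) r c ∎

theorem3 : ∀ {c ℓ : Level} (K : Field c ℓ) (n : ℕ) (G : SimpleGraph n) →
  Connected G →
  let open Field K
      open Matrices K
  in (A : Mat n) →
     (∀ i j → ¬ (i ≡ j) → ¬ SimpleGraph.Adj G i j → A i j ≈ 0#) →
     (ω : List (Fin n)) →
     (∀ i → 1 ≤ count i ω) →
     let s = λ i → count i ω
         B = expand (A -M I) s
     in Σ (BMat s) λ M →
          ((IB -B restrict B (bar ω)) *B M) ≈B IB
          × (M *B (IB -B restrict B (bar ω))) ≈B IB
          × sysMap A ω ≈M (I +M (compress s M *M (A -M I)))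
theorem3 K n G _ A _ ω _ = Mω , Mω-inverseˡ , Mω-inverseʳ , sysMap-compressed
  where open LinearAlgebra.WordSystem K A ω
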